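{- Let $k\geq 2$ be an integer. Every countable graph, and every countable acyclic digraph, is $(1/k)$-majority $(k+1)$-choosable: for every system of lists $(L(v))_{v}$ with $|L(v)|=k+1$ for each vertex $v$, there is a $(1/k)$-majority colouring $\chi$ with $\chi(v)\in L(v)$ for every vertex $v$.
   Context: For a graph, the relevant edges at a vertex $v$ are all edges incident with $v$ (neighbours of $v$); for a digraph, they are the out-edges $v\to u$ (outneighbours of $v$). A $(1/k)$-majority colouring is an assignment $\chi$ of colours to vertices such that for every vertex $v$: if $v$ has finitely many relevant edges, at most a $1/k$ proportion of them are monochromatic (join $v$ to a vertex $u$ with $\chi(u)=\chi(v)$); if $v$ has infinitely many relevant edges, then infinitely many of them join $v$ to a vertex $u$ with $\chi(u)\neq\chi(v)$. A graph/digraph is $(1/k)$-majority $\ell$-choosable if for every system of lists of size $\ell$ there is a $(1/k)$-majority colouring choosing each vertex's colour from its list. An acyclic digraph is one with no directed cycle. -}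

module Defs where

open import Level using (0ℓ)
open import Data.Nat using (ℕ; _*_; _≤_; suc)
open import Data.Product using (Σ; ∃; _×_)
open import Data.List using (List; length)
open import Data.List.Membership.Propositional using (_∈_; _∉_)
open import Data.List.Relation.Unary.Unique.Propositional using (Unique)
open import Relation.Binary.PropositionalEquality using (_≡_; _≢_)
open import Relation.Binary.Construct.Closure.Transitive using (TransClosure)
open import Relation.Nullary using (¬_)
open import Function.Bundles using (_⇔_)
open import Function.Definitions using (Injective)

Enumerates : {V : Set} → (V → Set) → List V → Set
Enumerates {V} P l = Unique l × (∀ (u : V) → P u ⇔ (u ∈ l))

FiniteSet : {V : Set} → (V → Set) → Set
FiniteSet {V} P = Σ (List V) (Enumerates P)

Countable : Set → Set
Countable V = Σ (V → ℕ) (Injective _≡_ _≡_)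

-- (1/k)-majority condition at vertex v, where R v u means "the edge
-- v—u (graph) resp. v→u (digraph) is a relevant edge at v".
--  * if v has finitely many relevant edges, enumerated by l, then every
--    duplicate-free list m of monochromatic relevant neighbours satisfies
--    k·|m| ≤ |l|  (i.e. at most a 1/k proportion is monochromatic);
--  * if v has infinitely many relevant edges, then for every finite list
--    xs there is a relevant neighbour u outside xs with χ u ≠ χ v
--    (i.e. infinitely many relevant edges are non-monochromatic).
MajorityAt : {V C : Set} → ℕ → (V → V → Set) → (V → C) → V → Set
MajorityAt {V} k R χ v =
  (∀ (l : List V) → Enumerates (R v) l →
     ∀ (m : List V) → Unique m →
     (∀ {u} → u ∈ m → R v u × χ u ≡ χ v) →
     k * length m ≤ length l)
  ×
  (¬ FiniteSet (R v) →
     ∀ (xs : List V) → ∃ λ u → R v u × u ∉ xs × χ u ≢ χ v)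

MajorityColouring : {V C : Set} → ℕ → (V → V → Set) → (V → C) → Set
MajorityColouring {V} k R χ = ∀ (v : V) → MajorityAt k R χ v

ListAssignment : (V C : Set) → ℕ → (V → List C) → Set
ListAssignment V C ℓ L = ∀ (v : V) → Unique (L v) × length (L v) ≡ ℓ

MajorityChoosable : (V : Set) → ℕ → ℕ → (V → V → Set) → Set₁
MajorityChoosable V k ℓ R =
  ∀ (C : Set) (L : V → List C) → ListAssignment V C ℓ L →
  ∃ λ (χ : V → C) → (∀ v → χ v ∈ L v) × MajorityColouring k R χ

IsGraph : {V : Set} → (V → V → Set) → Set
IsGraph {V} E = (∀ {u v : V} → E u v → E v u) × (∀ (v : V) → ¬ E v v)

IsAcyclic : {V : Set} → (V → V → Set) → Set
IsAcyclic {V} D = ∀ (v : V) → ¬ TransClosure D v v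

-- With lists of k colours at the constrained vertices, some colour of u's list is used by at
-- most a 1/k share of the relevant neighbours of u.  In a graph, recolouring a violating vertex with such a
-- colour strictly decreases the number of monochromatic edges; in an acyclic digraph, one colours a sink of
-- the remaining vertices each time, as its out-neighbours are never recoloured afterwards.
--
-- Along an enumeration of the vertices, König's lemma over the finitely many list colours turns
-- colourings of all finite prefixes into one colouring, which satisfies the condition at every vertex of
-- finite degree.
--
-- Vertices of infinite degree.  Each one designates infinitely many out-neighbours of larger index, and no
-- vertex is designated twice.  In index order every vertex gets a precolour from its list that differs from
-- its designator's.  A vertex of infinite degree keeps only its precolour; a vertex of finite degree deletes
-- its designator's precolour from its list of k + 1, which leaves k colours for the finite case.

module Submission where

open import Level using (0ℓ)
open import Axiom.ExcludedMiddle using (ExcludedMiddle)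
open import Data.Nat using (ℕ; zero; suc; _+_; _*_; _⊔_; _≤_; _<_; z≤n; s≤s; z<s; _≤?_)
open import Data.Nat.Properties hiding (_≟_)
open import Data.Nat.Induction using (<-wellFounded)
open import Induction.WellFounded using (Acc; acc)
open import Data.Product using (Σ; ∃; _×_; _,_; proj₁; proj₂)
open import Data.Sum using (_⊎_; inj₁; inj₂; [_,_]′)
open import Data.List using (List; []; _∷_; length; map; foldr; filter; deduplicate)
open import Data.List.Relation.Binary.Subset.Propositional using (_⊆_)
open import Data.List.Extrema.Nat using (max; xs≤max)
open import Data.List.Properties using (filter-accept; filter-reject; filter-all; filter-notAll)
open import Data.List.Membership.Propositional using (_∈_; _∉_)
open import Data.List.Membership.Propositional.Properties using (∈-map⁺; ∈-filter⁺; ∈-filter⁻; ∈-deduplicate⁺; ∈-deduplicate⁻)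
open import Data.List.Relation.Unary.All as All using (All; []; _∷_)
open import Data.List.Relation.Unary.Any as Any using (here; there)
open import Data.List.Relation.Unary.AllPairs using ([]; _∷_)
open import Data.List.Relation.Unary.Unique.Propositional using (Unique)
open import Data.List.Relation.Unary.Unique.DecPropositional.Properties using (deduplicate-!)
open import Data.List.Relation.Unary.Unique.Propositional.Properties using (filter⁺)
open import Data.Unit using (⊤; tt)
open import Relation.Nullary using (¬_; Dec; yes; no; ¬?; contradiction)
open import Relation.Nullary.Decidable using (decidable-stable)
open import Relation.Binary.Definitions using (DecidableEquality)
open import Relation.Binary.PropositionalEquality
open import Function using (_∘′_; id)
open import Function.Bundles using (mk⇔; Equivalence)
open import Algebra.Properties.CommutativeSemigroup +-commutativeSemigroup using (interchange; x∙yz≈y∙xz)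
open import Relation.Binary.Construct.Closure.Transitive using (TransClosure; [_]) renaming (_++_ to _⁺++⁺_)
open import Function.Definitions using (Injective)
open import Defs

descent : {S : Set} {G : S → Set} (Φ : S → ℕ) → (∀ s → G s ⊎ ∃ λ s′ → Φ s′ < Φ s) → S → ∃ G
descent {G = G} Φ step s = go s (<-wellFounded (Φ s))
  where
  go : ∀ s → Acc _<_ (Φ s) → ∃ G
  go s (acc smaller) with step s
  ... | inj₁ g = s , g
  ... | inj₂ (s′ , Φs′<Φs) = go s′ (smaller Φs′<Φs)

bound-witnesses : {A : Set} (Q : A → ℕ → Set) (cs : List A) → (∀ {c} → c ∈ cs → ∃ (Q c)) →
                  ∃ λ M → ∀ {c} → c ∈ cs → ∃ λ m → m ≤ M × Q c m
bound-witnesses Q [] _ = 0 , λ ()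
bound-witnesses Q (c ∷ cs) witness =
  let m₀ , q₀ = witness (here refl)
      M , bounded = bound-witnesses Q cs (witness ∘′ there)
  in m₀ ⊔ M , λ { (here refl) → m₀ , m≤m⊔n m₀ M , q₀
               ; (there c∈) → let m , m≤M , q = bounded c∈ in m , ≤-trans m≤M (m≤n⊔m m₀ M) , q }

foldr-preserves : {A B : Set} {P : B → Set} {f : A → B → B} → (∀ x {y} → P y → P (f x y)) →
                  ∀ {e} → P e → ∀ xs → P (foldr f e xs)
foldr-preserves preserves Pe [] = Pe
foldr-preserves preserves Pe (x ∷ xs) = preserves x (foldr-preserves preserves Pe xs)

Unique-targets⇒functional : {A B : Set} {ps : List (A × B)} → Unique (map proj₂ ps) →
                            ∀ {a a′ b} → (a , b) ∈ ps → (a′ , b) ∈ ps → a ≡ a′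
Unique-targets⇒functional _ (here refl) (here refl) = refl
Unique-targets⇒functional (b∉ ∷ _) (here refl) (there q) = contradiction refl (All.lookup b∉ (∈-map⁺ proj₂ q))
Unique-targets⇒functional (b∉ ∷ _) (there p) (here refl) = contradiction refl (All.lookup b∉ (∈-map⁺ proj₂ p))
Unique-targets⇒functional (_ ∷ targets!) (there p) (there q) = Unique-targets⇒functional targets! p q

firstOf : {A : Set} (xs : List A) → .(0 < length xs) → A
firstOf (x ∷ _) _ = x

firstOf-∈ : {A : Set} (xs : List A) .(nonempty : 0 < length xs) → firstOf xs nonempty ∈ xs
firstOf-∈ (x ∷ _) _ = here refl

firstOf-cong : {A : Set} {xs ys : List A} .{p : 0 < length xs} .{q : 0 < length ys} → xs ≡ ys → firstOf xs p ≡ firstOf ys q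
firstOf-cong refl = refl

ListColouring : {V C : Set} → (V → List C) → (V → C) → Set
ListColouring L χ = ∀ v → χ v ∈ L v

module Classical (em : ExcludedMiddle 0ℓ) where

  ¬∀⇒∃¬ : {A : Set} {Q : A → Set} → ¬ (∀ a → Q a) → ∃ λ a → ¬ Q a
  ¬∀⇒∃¬ {Q = Q} ¬∀ with em {∃ λ a → ¬ Q a}
  ... | yes ∃¬ = ∃¬
  ... | no ¬∃¬ = contradiction (λ a → decide a em) ¬∀
    where
    decide : ∀ a → Dec (Q a) → Q a
    decide a (yes q) = q
    decide a (no ¬q) = contradiction (a , ¬q) ¬∃¬

  module _ {A : Set} where

    _≟_ : DecidableEquality A
    x ≟ y = em

    finite-from-cover : (P : A → Set) (zs : List A) → (∀ x → P x → x ∈ zs) → FiniteSet P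
    finite-from-cover P zs cover =
      deduplicate _≟_ (filter P? zs) , deduplicate-! _≟_ _ ,
      λ x → mk⇔ (λ px → ∈-deduplicate⁺ _≟_ (∈-filter⁺ P? (cover x px) px))
                (λ x∈ → proj₂ (∈-filter⁻ P? {xs = zs} (∈-deduplicate⁻ _≟_ _ x∈)))
      where
      P? : ∀ x → Dec (P x)
      P? x = em

    _[_]≔_ : {C : Set} → (A → C) → A → C → A → C
    (χ [ u ]≔ c) w with w ≟ u
    ... | yes _ = c
    ... | no _ = χ w

    ≔-same : {C : Set} (χ : A → C) (u : A) (c : C) → (χ [ u ]≔ c) u ≡ c
    ≔-same χ u c with u ≟ u
    ... | yes _ = refl
    ... | no u≢u = contradiction refl u≢u

    ≔-other : {C : Set} (χ : A → C) {u w : A} (c : C) → w ≢ u → (χ [ u ]≔ c) w ≡ χ w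
    ≔-other χ {u} {w} c w≢u with w ≟ u
    ... | yes w≡u = contradiction w≡u w≢u
    ... | no _ = refl

    ≔-colouring : ∀ {C : Set} {L : A → List C} {χ u c} → ListColouring L χ → c ∈ L u → ListColouring L (χ [ u ]≔ c)
    ≔-colouring {u = u} χ∈ c∈ w with w ≟ u
    ... | yes refl = c∈
    ... | no _ = χ∈ w

    infixl 6 _∖_
    _∖_ : List A → A → List A
    xs ∖ y = filter (λ x → ¬? (x ≟ y)) xs

    ∈-∖⁻ : ∀ {x y} (xs : List A) → x ∈ xs ∖ y → x ∈ xs × x ≢ y
    ∈-∖⁻ xs = ∈-filter⁻ (λ x → ¬? (x ≟ _)) {xs = xs}

    ∈-∖⁺ : ∀ {x y xs} → x ∈ xs → x ≢ y → x ∈ xs ∖ y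
    ∈-∖⁺ = ∈-filter⁺ (λ x → ¬? (x ≟ _))

    ∖-unique : ∀ {xs} y → Unique xs → Unique (xs ∖ y)
    ∖-unique y = filter⁺ (λ x → ¬? (x ≟ y))

    ∖-∉ : ∀ {y} xs → y ∉ xs → xs ∖ y ≡ xs
    ∖-∉ {y} xs y∉ = filter-all (λ x → ¬? (x ≟ y)) (All.tabulate λ { x∈ refl → y∉ x∈ })

    ∖-cons : ∀ {x y : A} (xs : List A) → x ≢ y → (x ∷ xs) ∖ y ≡ x ∷ (xs ∖ y)
    ∖-cons {y = y} xs = filter-accept (λ z → ¬? (z ≟ y))

    ∖-head : ∀ {x : A} (xs : List A) → Unique (x ∷ xs) → (x ∷ xs) ∖ x ≡ xs
    ∖-head {x} xs (x∉xs ∷ _) =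
      trans (filter-reject (λ z → ¬? (z ≟ x)) (λ x≢x → x≢x refl)) (∖-∉ xs (λ x∈ → All.lookup x∉xs x∈ refl))

    length-∖≥ : ∀ {y} (xs : List A) → Unique xs → length xs ≤ suc (length (xs ∖ y))
    length-∖≥ [] _ = z≤n
    length-∖≥ {y} (x ∷ xs) xs!@(_ ∷ xs!′) = by-cases (x ≟ y)
      where
      by-cases : Dec (x ≡ y) → length (x ∷ xs) ≤ suc (length ((x ∷ xs) ∖ y))
      by-cases (yes refl) = ≤-reflexive (cong (suc ∘′ length) (sym (∖-head xs xs!)))
      by-cases (no x≢y) = subst (λ zs → length (x ∷ xs) ≤ suc (length zs)) (sym (∖-cons xs x≢y))
                                (s≤s (length-∖≥ xs xs!′))

    length-∖< : ∀ {y xs} → y ∈ xs → length (xs ∖ y) < length xs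
    length-∖< {y} {xs} y∈ = filter-notAll (λ x → ¬? (x ≟ y)) xs (Any.map (λ { refl x≢y → x≢y refl }) y∈)

  𝟙 : Set → ℕ
  𝟙 P with em {P}
  ... | yes _ = 1
  ... | no _ = 0

  𝟙-yes : {P : Set} → P → 𝟙 P ≡ 1
  𝟙-yes {P} p with em {P}
  ... | yes _ = refl
  ... | no ¬p = contradiction p ¬p

  𝟙-no : {P : Set} → ¬ P → 𝟙 P ≡ 0
  𝟙-no {P} ¬p with em {P}
  ... | yes p = contradiction p ¬p
  ... | no _ = refl

  𝟙-mono : {P Q : Set} → (P → Q) → 𝟙 P ≤ 𝟙 Q
  𝟙-mono {P} {Q} P⇒Q with em {P}
  ... | yes p = ≤-reflexive (sym (𝟙-yes (P⇒Q p)))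
  ... | no _ = z≤n

  𝟙-cong : {P Q : Set} → (P → Q) → (Q → P) → 𝟙 P ≡ 𝟙 Q
  𝟙-cong P⇒Q Q⇒P = ≤-antisym (𝟙-mono P⇒Q) (𝟙-mono Q⇒P)

  ∑ : {A : Set} → List A → (A → ℕ) → ℕ
  ∑ [] h = 0
  ∑ (x ∷ xs) h = h x + ∑ xs h

  count : {A : Set} → (A → Set) → List A → ℕ
  count P xs = ∑ xs (λ x → 𝟙 (P x))

  module _ {A : Set} where

    ∑-mono : ∀ {h h′ : A → ℕ} (xs : List A) → (∀ {x} → x ∈ xs → h x ≤ h′ x) → ∑ xs h ≤ ∑ xs h′
    ∑-mono [] h≤h′ = z≤n
    ∑-mono (x ∷ xs) h≤h′ = +-mono-≤ (h≤h′ (here refl)) (∑-mono xs (λ y∈ → h≤h′ (there y∈)))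

    ∑-cong : ∀ {h h′ : A → ℕ} (xs : List A) → (∀ {x} → x ∈ xs → h x ≡ h′ x) → ∑ xs h ≡ ∑ xs h′
    ∑-cong xs h≡h′ = ≤-antisym (∑-mono xs (≤-reflexive ∘′ h≡h′)) (∑-mono xs (≤-reflexive ∘′ sym ∘′ h≡h′))

    ∑-zero : (xs : List A) → ∑ xs (λ _ → 0) ≡ 0
    ∑-zero [] = refl
    ∑-zero (x ∷ xs) = ∑-zero xs

    ∑-+ : ∀ (h h′ : A → ℕ) (xs : List A) → ∑ xs (λ x → h x + h′ x) ≡ ∑ xs h + ∑ xs h′
    ∑-+ h h′ [] = refl
    ∑-+ h h′ (x ∷ xs) = trans (cong (h x + h′ x +_) (∑-+ h h′ xs)) (interchange (h x) (h′ x) _ _)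

    member≤∑ : ∀ {h : A → ℕ} {x} {xs : List A} → x ∈ xs → h x ≤ ∑ xs h
    member≤∑ {xs = y ∷ ys} (here refl) = m≤m+n _ _
    member≤∑ {h} {xs = y ∷ ys} (there x∈) = ≤-trans (member≤∑ {h} x∈) (m≤n+m _ (h y))

    ∑-∖ : ∀ (h : A → ℕ) {y} (xs : List A) → Unique xs → y ∈ xs → ∑ xs h ≡ h y + ∑ (xs ∖ y) h
    ∑-∖ h (x ∷ xs) xs! (here refl) = cong (λ zs → h x + ∑ zs h) (sym (∖-head xs xs!))
    ∑-∖ h {y} (x ∷ xs) (x∉xs ∷ xs!) (there y∈) = begin
      h x + ∑ xs h                   ≡⟨ cong (h x +_) (∑-∖ h xs xs! y∈) ⟩
      h x + (h y + ∑ (xs ∖ y) h)     ≡⟨ x∙yz≈y∙xz (h x) (h y) _ ⟩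
      h y + ∑ (x ∷ (xs ∖ y)) h       ≡⟨ cong (λ zs → h y + ∑ zs h) (sym (∖-cons xs x≢y)) ⟩
      h y + ∑ ((x ∷ xs) ∖ y) h       ∎
      where
      open ≡-Reasoning
      x≢y : x ≢ y
      x≢y refl = All.lookup x∉xs y∈ refl

    count-mono : ∀ {P Q : A → Set} (xs : List A) → (∀ {x} → x ∈ xs → P x → Q x) → count P xs ≤ count Q xs
    count-mono xs P⇒Q = ∑-mono xs (λ x∈ → 𝟙-mono (P⇒Q x∈))

    count-cong : ∀ {P Q : A → Set} (xs : List A) → (∀ {x} → x ∈ xs → P x → Q x) → (∀ {x} → x ∈ xs → Q x → P x) →
                 count P xs ≡ count Q xs
    count-cong xs P⇒Q Q⇒P = ∑-cong xs (λ x∈ → 𝟙-cong (P⇒Q x∈) (Q⇒P x∈))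

    count-⊤ : (xs : List A) → count (λ _ → ⊤) xs ≡ length xs
    count-⊤ [] = refl
    count-⊤ (x ∷ xs) = cong₂ _+_ (𝟙-yes tt) (count-⊤ xs)

    count-member : ∀ {P : A → Set} {x} {xs : List A} → x ∈ xs → P x → 1 ≤ count P xs
    count-member {P} x∈ px = ≤-trans (≤-reflexive (sym (𝟙-yes px))) (member≤∑ {λ x → 𝟙 (P x)} x∈)

    count-≡≤1 : (a : A) (xs : List A) → Unique xs → count (a ≡_) xs ≤ 1
    count-≡≤1 a [] _ = z≤n
    count-≡≤1 a (x ∷ xs) (x∉xs ∷ xs!) with a ≟ x
    ... | yes refl = ≤-reflexive (cong suc (trans
          (∑-cong xs (λ x′∈ → 𝟙-no (λ { refl → All.lookup x∉xs x′∈ refl }))) (∑-zero xs)))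
    ... | no a≢x = count-≡≤1 a xs xs!

  ∑-swap : {A B : Set} (g : A → B → ℕ) (xs : List A) (ys : List B) →
           ∑ xs (λ x → ∑ ys (g x)) ≡ ∑ ys (λ y → ∑ xs (λ x → g x y))
  ∑-swap g [] ys = sym (∑-zero ys)
  ∑-swap g (x ∷ xs) ys =
    trans (cong (∑ ys (g x) +_) (∑-swap g xs ys)) (sym (∑-+ (g x) (λ y → ∑ xs (λ x → g x y)) ys))

  count-fibres : {A B : Set} (Q : A → Set) (φ : A → B) (xs : List A) (cs : List B) → Unique cs →
                 ∑ cs (λ c → count (λ y → Q y × φ y ≡ c) xs) ≤ count Q xs
  count-fibres Q φ xs cs cs! = begin
    ∑ cs (λ c → count (λ y → Q y × φ y ≡ c) xs)       ≡⟨ ∑-swap (λ c y → 𝟙 (Q y × φ y ≡ c)) cs xs ⟩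
    ∑ xs (λ y → count (λ c → Q y × φ y ≡ c) cs)       ≤⟨ ∑-mono xs (λ {y} _ → fibre y) ⟩
    count Q xs                                         ∎
    where
    open ≤-Reasoning
    fibre : ∀ y → count (λ c → Q y × φ y ≡ c) cs ≤ 𝟙 (Q y)
    fibre y with em {Q y}
    ... | yes _ = ≤-trans (count-mono cs (λ _ → proj₂)) (count-≡≤1 (φ y) cs cs!)
    ... | no ¬q = ≤-reflexive (trans (∑-cong cs (λ _ → 𝟙-no (¬q ∘′ proj₁))) (∑-zero cs))

  count-transfer : {A : Set} {P Q : A → Set} (xs ys : List A) → Unique xs →
                   (∀ {x} → x ∈ xs → P x → x ∈ ys × Q x) → count P xs ≤ count Q ys
  count-transfer {P = P} {Q} xs ys xs! embed = begin
    count P xs                                    ≤⟨ ∑-mono xs (λ {x} x∈ → found x∈ em) ⟩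
    ∑ xs (λ x → count (λ y → Q y × y ≡ x) ys)     ≤⟨ count-fibres Q id ys xs xs! ⟩
    count Q ys                                    ∎
    where
    open ≤-Reasoning
    found : ∀ {x} → x ∈ xs → Dec (P x) → 𝟙 (P x) ≤ count (λ y → Q y × y ≡ x) ys
    found x∈ (yes px) = ≤-trans (≤-reflexive (𝟙-yes px)) (count-member (proj₁ (embed x∈ px)) (proj₂ (embed x∈ px) , refl))
    found x∈ (no ¬px) = ≤-trans (≤-reflexive (𝟙-no ¬px)) z≤n

  length≤count : {A : Set} {P : A → Set} (ms xs : List A) → Unique ms → (∀ {x} → x ∈ ms → x ∈ xs × P x) →
                 length ms ≤ count P xs
  length≤count ms xs ms! embed = subst (_≤ _) (count-⊤ ms) (count-transfer ms xs ms! (λ x∈ _ → embed x∈))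

  count≤enumeration : {A : Set} {P : A → Set} {l : List A} (xs : List A) → Unique xs → Enumerates P l →
                      count P xs ≤ length l
  count≤enumeration {l = l} xs xs! (_ , enum) =
    subst (_ ≤_) (count-⊤ l) (count-transfer xs l xs! (λ {x} _ px → Equivalence.to (enum x) px , tt))

  ∃-below-average : {A : Set} (g : A → ℕ) {a : A} (cs : List A) → a ∈ cs →
                    ∃ λ c → c ∈ cs × length cs * g c ≤ ∑ cs g
  ∃-below-average g (c ∷ []) _ = c , here refl , ≤-refl
  ∃-below-average g (c ∷ c′ ∷ cs) _ with ∃-below-average g (c′ ∷ cs) (here refl)
  ... | d , d∈ , d-below with ≤-total (g c) (g d)
  ... | inj₁ c≤d = c , here refl , +-monoʳ-≤ (g c) (≤-trans (*-monoʳ-≤ (length (c′ ∷ cs)) c≤d) d-below)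
  ... | inj₂ d≤c = d , there d∈ , +-mono-≤ d≤c d-below

  ∃-light-fibre : {A B : Set} (Q : A → Set) (φ : A → B) (xs : List A) {b : B} (cs : List B) → Unique cs → b ∈ cs →
                  ∃ λ c → c ∈ cs × length cs * count (λ y → Q y × φ y ≡ c) xs ≤ count Q xs
  ∃-light-fibre Q φ xs cs cs! b∈ =
    let c , c∈ , c-below = ∃-below-average (λ c → count (λ y → Q y × φ y ≡ c) xs) cs b∈
    in c , c∈ , ≤-trans c-below (count-fibres Q φ xs cs cs!)

module Colouring (em : ExcludedMiddle 0ℓ) (k : ℕ) {V : Set} (R : V → V → Set) where

  open Classical em

  Mono : {C : Set} → (V → C) → V → V → Set
  Mono χ u y = R u y × χ y ≡ χ u

  MajorityOn : {C : Set} → (V → Set) → List V → (V → C) → Set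
  MajorityOn P X χ = ∀ {u} → u ∈ X → P u → k * count (Mono χ u) X ≤ count (R u) X

  FiniteMajorityAt : {C : Set} → (V → C) → V → Set
  FiniteMajorityAt χ v =
    ∀ (l : List V) → Enumerates (R v) l → ∀ (m : List V) → Unique m → (∀ {u} → u ∈ m → Mono χ v u) → k * length m ≤ length l

  module _ {C : Set} where
    ∃-good-colour : (χ : V → C) (X : List V) (u : V) {b : C} (cs : List C) → Unique cs → k ≤ length cs → b ∈ cs →
                    ∃ λ c → c ∈ cs × k * count (λ y → R u y × χ y ≡ c) X ≤ count (R u) X
    ∃-good-colour χ X u cs cs! k≤ b∈ =
      let c , c∈ , light = ∃-light-fibre (R u) χ X cs cs! b∈
      in c , c∈ , ≤-trans (*-monoˡ-≤ _ k≤) light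

    count-Mono-recoloured : ∀ {χ χ′ : V → C} {u c} (X : List V) → χ′ u ≡ c → (∀ {y} → R u y → χ′ y ≡ χ y) →
                            count (Mono χ′ u) X ≡ count (λ y → R u y × χ y ≡ c) X
    count-Mono-recoloured X χ′u≡c same = count-cong X
      (λ { _ (r , eq) → r , trans (sym (same r)) (trans eq χ′u≡c) })
      (λ { _ (r , eq) → r , trans (same r) (trans eq (sym χ′u≡c)) })

FinitelyColourable : ExcludedMiddle 0ℓ → ℕ → {V : Set} → (V → V → Set) → Set₁
FinitelyColourable em k {V} R =
  ∀ {C : Set} (L : V → List C) → (∀ u → FiniteSet (R u) → Unique (L u) × k ≤ length (L u)) →
  ∀ (χ₀ : V → C) → ListColouring L χ₀ →
  ∀ (Y : List V) → Unique Y → ∃ λ χ → ListColouring L χ × MajorityOn (λ u → FiniteSet (R u)) Y χ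
  where open Colouring em k R

module GraphMajority (em : ExcludedMiddle 0ℓ) (k : ℕ) {V : Set} (E : V → V → Set) (graph : IsGraph E) where

  open Classical em
  open Colouring em k E

  private
    symmetric : ∀ {u v} → E u v → E v u
    symmetric = proj₁ graph
    irreflexive : ∀ v → ¬ E v v
    irreflexive = proj₂ graph

  module _ {C : Set} where

    potential : (V → C) → List V → ℕ
    potential χ X = ∑ X (λ x → count (Mono χ x) X)

    potential-cong : ∀ {χ χ′ : V → C} (X : List V) → (∀ {x} → x ∈ X → χ x ≡ χ′ x) → potential χ X ≡ potential χ′ X
    potential-cong X agree = ∑-cong X λ x∈ → count-cong X
      (λ { y∈ (e , eq) → e , trans (sym (agree y∈)) (trans eq (agree x∈)) })
      (λ { y∈ (e , eq) → e , trans (agree y∈) (trans eq (sym (agree x∈))) })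

    -- Each monochromatic edge at u is counted once from u and once from its other end.
    potential-split : (χ : V → C) {u : V} (X : List V) → Unique X → u ∈ X →
                      potential χ X ≡ count (Mono χ u) X + (count (Mono χ u) X + potential χ (X ∖ u))
    potential-split χ {u} X X! u∈ = begin
      potential χ X
        ≡⟨ ∑-∖ (λ x → count (Mono χ x) X) X X! u∈ ⟩
      a + ∑ (X ∖ u) (λ x → count (Mono χ x) X)
        ≡⟨ cong (a +_) (∑-cong (X ∖ u) (λ _ → ∑-∖ (λ y → 𝟙 (Mono χ _ y)) X X! u∈)) ⟩
      a + ∑ (X ∖ u) (λ x → 𝟙 (Mono χ x u) + count (Mono χ x) (X ∖ u))
        ≡⟨ cong (a +_) (∑-+ (λ x → 𝟙 (Mono χ x u)) (λ x → count (Mono χ x) (X ∖ u)) (X ∖ u)) ⟩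
      a + (count (λ x → Mono χ x u) (X ∖ u) + potential χ (X ∖ u))
        ≡⟨ cong (λ n → a + (n + potential χ (X ∖ u))) (trans (count-cong (X ∖ u) (λ _ → flip) (λ _ → flip)) (sym a≡)) ⟩
      a + (a + potential χ (X ∖ u))
        ∎
      where
      open ≡-Reasoning
      a : ℕ
      a = count (Mono χ u) X
      flip : ∀ {x y} → Mono χ x y → Mono χ y x
      flip (e , eq) = symmetric e , sym eq
      a≡ : a ≡ count (Mono χ u) (X ∖ u)
      a≡ = trans (∑-∖ (λ y → 𝟙 (Mono χ u y)) X X! u∈) (cong (_+ count (Mono χ u) (X ∖ u)) (𝟙-no (irreflexive u ∘′ proj₁)))

    recolouring-decreases-potential :
      (χ : V → C) {u : V} (c : C) (X : List V) → Unique X → u ∈ X →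
      count (λ y → E u y × χ y ≡ c) X < count (Mono χ u) X →
      potential (χ [ u ]≔ c) X < potential χ X
    recolouring-decreases-potential χ {u} c X X! u∈ fewer = begin-strict
      potential χ′ X                  ≡⟨ potential-split χ′ X X! u∈ ⟩
      b + (b + potential χ′ (X ∖ u))  ≡⟨ cong (λ n → b + (b + n)) (potential-cong (X ∖ u) unchanged) ⟩
      b + (b + potential χ (X ∖ u))   <⟨ +-mono-<-≤ b<a (+-monoˡ-≤ _ (<⇒≤ b<a)) ⟩
      a + (a + potential χ (X ∖ u))   ≡⟨ potential-split χ X X! u∈ ⟨
      potential χ X                   ∎
      where
      open ≤-Reasoning
      χ′ : V → C
      χ′ = χ [ u ]≔ c
      a b : ℕ
      a = count (Mono χ u) X
      b = count (Mono χ′ u) X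
      unchanged : ∀ {x} → x ∈ X ∖ u → χ′ x ≡ χ x
      unchanged x∈ = ≔-other χ _ (proj₂ (∈-∖⁻ X x∈))
      b<a : b < a
      b<a = subst (_< a) (sym (count-Mono-recoloured X (≔-same χ u c) (λ e → ≔-other χ c λ { refl → irreflexive u e }))) fewer

  module _ {C : Set} (L : V → List C) (P : V → Set) (L-size : ∀ u → P u → Unique (L u) × k ≤ length (L u)) where

    majority-on-graph : ∀ (χ₀ : V → C) → ListColouring L χ₀ → ∀ (X : List V) → Unique X →
                        ∃ λ χ → ListColouring L χ × MajorityOn P X χ
    majority-on-graph χ₀ χ₀∈ X X! =
      let (χ , χ∈) , maj = descent (λ s → potential (proj₁ s) X) improve (χ₀ , χ₀∈) in χ , χ∈ , maj
      where
      Unhappy : (V → C) → V → Set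
      Unhappy χ u = u ∈ X × P u × ¬ (k * count (Mono χ u) X ≤ count (E u) X)
      improve : (s : Σ (V → C) (ListColouring L)) → MajorityOn P X (proj₁ s) ⊎
                ∃ λ (s′ : Σ (V → C) (ListColouring L)) → potential (proj₁ s′) X < potential (proj₁ s) X
      improve (χ , χ∈) with em {∃ (Unhappy χ)}
      ... | no none = inj₁ λ {u} u∈ pu → decidable-stable (_ ≤? _) λ unhappy → none (u , u∈ , pu , unhappy)
      ... | yes (u , u∈ , pu , unhappy) =
        let c , c∈ , good = ∃-good-colour χ X u (L u) (proj₁ (L-size u pu)) (proj₂ (L-size u pu)) (χ∈ u)
            fewer = ≰⇒> (λ a≤b → unhappy (≤-trans (*-monoʳ-≤ k a≤b) good))
        in inj₂ ((χ [ u ]≔ c , ≔-colouring χ∈ c∈) , recolouring-decreases-potential χ c X X! u∈ fewer)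

module AcyclicMajority (em : ExcludedMiddle 0ℓ) (k : ℕ) {V : Set} (D : V → V → Set) (acyclic : IsAcyclic D) where

  open Classical em
  open Colouring em k D

  ∃-sink : (x : V) (S : List V) → ∃ λ u → u ∈ x ∷ S × ∀ {y} → y ∈ x ∷ S → ¬ D u y
  ∃-sink x S = let u , u∈ , unreachable = ∃-maximal x S in u , u∈ , λ y∈ e → unreachable y∈ [ e ]
    where
    ∃-maximal : (x : V) (S : List V) → ∃ λ u → u ∈ x ∷ S × ∀ {y} → y ∈ x ∷ S → ¬ TransClosure D u y
    ∃-maximal x [] = x , here refl , λ { (here refl) → acyclic x }
    ∃-maximal x (z ∷ S) with ∃-maximal z S
    ... | u , u∈ , unreachable with em {TransClosure D u x}
    ...   | no ¬u⇝x = u , there u∈ , λ { (here refl) → ¬u⇝x ; (there y∈) → unreachable y∈ }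
    ...   | yes u⇝x = x , here refl , λ { (here refl) → acyclic x ; (there y∈) x⇝y → unreachable y∈ (u⇝x ⁺++⁺ x⇝y) }

  module _ {C : Set} (L : V → List C) (P : V → Set) (L-size : ∀ u → P u → Unique (L u) × k ≤ length (L u)) where

    sinks-first : (X S : List V) → Acc _<_ (length S) → (∀ {u} → u ∈ S → P u) → (χ : V → C) → ListColouring L χ →
                  ∃ λ χ′ → ListColouring L χ′ × (∀ {v} → v ∉ S → χ′ v ≡ χ v) × MajorityOn (_∈ S) X χ′
    sinks-first X [] _ _ χ χ∈ = χ , χ∈ , (λ _ → refl) , λ _ ()
    sinks-first X (x ∷ S) (acc smaller) inP χ χ∈
      with u , u∈ , sink ← ∃-sink x S
      with c , c∈ , good ← ∃-good-colour χ X u (L u) (proj₁ (L-size u (inP u∈))) (proj₂ (L-size u (inP u∈))) (χ∈ u)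
      with χ′ , χ′∈ , outside , happy ← sinks-first X ((x ∷ S) ∖ u) (smaller (length-∖< u∈))
                                          (λ w∈ → inP (proj₁ (∈-∖⁻ (x ∷ S) w∈))) (χ [ u ]≔ c) (≔-colouring χ∈ c∈)
      = χ′ , χ′∈ , outside′ , happy′
      where
      outside′ : ∀ {v} → v ∉ x ∷ S → χ′ v ≡ χ v
      outside′ v∉ = trans (outside (v∉ ∘′ proj₁ ∘′ ∈-∖⁻ (x ∷ S))) (≔-other χ c λ { refl → v∉ u∈ })
      χ′u≡c : χ′ u ≡ c
      χ′u≡c = trans (outside (λ u∈′ → proj₂ (∈-∖⁻ (x ∷ S) u∈′) refl)) (≔-same χ u c)
      happy′ : MajorityOn (_∈ x ∷ S) X χ′
      happy′ {w} w∈X w∈ with w ≟ u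
      ... | yes refl = subst (λ n → k * n ≤ count (D u) X)
                         (sym (count-Mono-recoloured X χ′u≡c (λ e → outside′ (λ y∈ → sink y∈ e)))) good
      ... | no w≢u = happy w∈X (∈-∖⁺ w∈ w≢u)

    majority-on-acyclic : ∀ (χ₀ : V → C) → ListColouring L χ₀ → ∀ (X : List V) →
                          ∃ λ χ → ListColouring L χ × MajorityOn P X χ
    majority-on-acyclic χ₀ χ₀∈ X =
      let χ , χ∈ , _ , happy = sinks-first X S (<-wellFounded _) (λ u∈ → proj₂ (∈-filter⁻ P? {xs = X} u∈)) χ₀ χ₀∈
      in χ , χ∈ , λ u∈ pu → happy u∈ (∈-filter⁺ P? u∈ pu)
      where
      P? : ∀ u → Dec (P u)
      P? u = em
      S : List V
      S = filter P? X

module Indexing (em : ExcludedMiddle 0ℓ) {V : Set} (index : V → ℕ) (index-injective : Injective _≡_ _≡_ index) where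

  prefix : ℕ → List V
  prefix zero = []
  prefix (suc n) with em {∃ λ v → index v ≡ n}
  ... | yes (v , _) = v ∷ prefix n
  ... | no _ = prefix n

  ∈-prefix⁻ : ∀ {v} n → v ∈ prefix n → index v < n
  ∈-prefix⁻ (suc n) v∈ with em {∃ λ v → index v ≡ n}
  ∈-prefix⁻ (suc n) (here refl) | yes (_ , refl) = ≤-refl
  ∈-prefix⁻ (suc n) (there v∈) | yes _ = m<n⇒m<1+n (∈-prefix⁻ n v∈)
  ∈-prefix⁻ (suc n) v∈ | no _ = m<n⇒m<1+n (∈-prefix⁻ n v∈)

  ∈-prefix⁺ : ∀ {v} n → index v < n → v ∈ prefix n
  ∈-prefix⁺ {v} (suc n) v<1+n with em {∃ λ v → index v ≡ n} | m<1+n⇒m<n∨m≡n v<1+n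
  ... | yes (w , refl) | inj₂ v≡w = here (index-injective v≡w)
  ... | yes _ | inj₁ v<n = there (∈-prefix⁺ n v<n)
  ... | no none | inj₂ refl = contradiction (v , refl) none
  ... | no _ | inj₁ v<n = ∈-prefix⁺ n v<n

  prefix-unique : ∀ n → Unique (prefix n)
  prefix-unique zero = []
  prefix-unique (suc n) with em {∃ λ v → index v ≡ n}
  ... | yes (v , v↦n) = All.tabulate (λ { w∈ refl → <-irrefl v↦n (∈-prefix⁻ n w∈) }) ∷ prefix-unique n
  ... | no _ = prefix-unique n

  maxIndex : List V → ℕ
  maxIndex vs = max 0 (map index vs)

  index≤maxIndex : ∀ {v vs} → v ∈ vs → index v ≤ maxIndex vs
  index≤maxIndex {vs = vs} v∈ = All.lookup (xs≤max 0 (map index vs)) (∈-map⁺ index v∈)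

  >maxIndex⇒∉ : ∀ {v vs} → maxIndex vs < index v → v ∉ vs
  >maxIndex⇒∉ max<v v∈ = <⇒≱ max<v (index≤maxIndex v∈)

module Compactness (em : ExcludedMiddle 0ℓ) (k : ℕ) {V C : Set} (index : V → ℕ) (index-injective : Injective _≡_ _≡_ index)
    (R : V → V → Set) (L : V → List C)
    (finitely : ∀ (Y : List V) → Unique Y → ∃ λ χ → ListColouring L χ × Colouring.MajorityOn em k R (λ u → FiniteSet (R u)) Y χ)
    where

  open Classical em
  open Colouring em k R
  open Indexing em index index-injective

  -- Measured against the whole finite neighbourhood, so that GoodUpTo m is downward closed in m.
  GoodUpTo : ℕ → (V → C) → Set
  GoodUpTo m χ = ListColouring L χ ×
                 ∀ {u} → u ∈ prefix m → (fs : FiniteSet (R u)) → k * count (Mono χ u) (prefix m) ≤ length (proj₁ fs)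

  ∃-GoodUpTo : ∀ m → ∃ (GoodUpTo m)
  ∃-GoodUpTo m =
    let χ , χ∈ , majority = finitely (prefix m) (prefix-unique m)
    in χ , χ∈ , λ u∈ fs → ≤-trans (majority u∈ fs) (count≤enumeration (prefix m) (prefix-unique m) (proj₂ fs))

  GoodUpTo-mono : ∀ {m n χ} → m ≤ n → GoodUpTo n χ → GoodUpTo m χ
  GoodUpTo-mono {m} {n} m≤n (χ∈ , good) = χ∈ , λ {u} u∈ fs → ≤-trans
    (*-monoʳ-≤ k (count-transfer (prefix m) (prefix n) (prefix-unique m) λ v∈ mono → inside v∈ , mono))
    (good (inside u∈) fs)
    where
    inside : ∀ {v} → v ∈ prefix m → v ∈ prefix n
    inside v∈ = ∈-prefix⁺ n (<-≤-trans (∈-prefix⁻ m v∈) m≤n)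

  Agree : ℕ → (V → C) → (V → C) → Set
  Agree n χ χ′ = ∀ {v} → index v < n → χ v ≡ χ′ v

  Extendable : ℕ → (V → C) → Set
  Extendable n χ = ∀ m → ∃ λ χ′ → Agree n χ χ′ × GoodUpTo m χ′

  -- König's lemma: of the finitely many colours available at v, one keeps the colouring extendable.
  extendable-at : ∀ {n v χ} → index v ≡ n → Extendable n χ → ∃ λ c → c ∈ L v × Extendable (suc n) (χ [ v ]≔ c)
  extendable-at {n} {v} {χ} v↦n extendable with em {∃ λ c → c ∈ L v × Extendable (suc n) (χ [ v ]≔ c)}
  ... | yes found = found
  ... | no none =
    let M , bounded = bound-witnesses (λ c m → ¬ Reachable c m) (L v) (λ c∈ → ¬∀⇒∃¬ λ ext → none (_ , c∈ , ext))
        χ′ , agree , good = extendable M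
        m , m≤M , unreachable = bounded (proj₁ good v)
    in contradiction (χ′ , (λ {w} → agrees agree {w}) , GoodUpTo-mono m≤M good) unreachable
    where
    Reachable : C → ℕ → Set
    Reachable c m = ∃ λ χ′ → Agree (suc n) (χ [ v ]≔ c) χ′ × GoodUpTo m χ′
    agrees : ∀ {χ′} → Agree n χ χ′ → Agree (suc n) (χ [ v ]≔ χ′ v) χ′
    agrees {χ′} agree {w} w<1+n with m<1+n⇒m<n∨m≡n w<1+n
    ... | inj₁ w<n = trans (≔-other χ (χ′ v) λ { refl → <-irrefl v↦n w<n }) (agree w<n)
    ... | inj₂ w↦n with index-injective (trans w↦n (sym v↦n))
    ...   | refl = ≔-same χ v (χ′ v)

  extend : ∀ n {χ} → Extendable n χ → ∃ λ χ₊ → Agree n χ χ₊ × Extendable (suc n) χ₊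
  extend n {χ} extendable with em {∃ λ v → index v ≡ n}
  ... | yes (v , v↦n) =
    let c , _ , extendable′ = extendable-at v↦n extendable
    in χ [ v ]≔ c , (λ w<n → sym (≔-other χ c λ { refl → <-irrefl v↦n w<n })) , extendable′
  ... | no nothing-at-n = χ , (λ _ → refl) , λ m →
    let χ′ , agree , good = extendable m
    in χ′ , (λ w<1+n → [ agree , (λ w↦n → contradiction (_ , w↦n) nothing-at-n) ]′ (m<1+n⇒m<n∨m≡n w<1+n)) , good

  chain : ∀ n → ∃ (Extendable n)
  chain zero = proj₁ (∃-GoodUpTo 0) , λ m → let χ′ , good = ∃-GoodUpTo m in χ′ , (λ ()) , good
  chain (suc n) = let χ₊ , _ , extendable = extend n (proj₂ (chain n)) in χ₊ , extendable

  chain-step : ∀ n → Agree n (proj₁ (chain n)) (proj₁ (chain (suc n)))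
  chain-step n = proj₁ (proj₂ (extend n (proj₂ (chain n))))

  chain-agree : ∀ {m n} → m ≤ n → Agree m (proj₁ (chain m)) (proj₁ (chain n))
  chain-agree {m} {n} m≤n with m≤n⇒m<n∨m≡n m≤n
  ... | inj₂ refl = λ _ → refl
  chain-agree {m} {suc n} _ | inj₁ m<1+n =
    λ v<m → trans (chain-agree (≤-pred m<1+n) v<m) (chain-step n (<-≤-trans v<m (≤-pred m<1+n)))

  limit : V → C
  limit v = proj₁ (chain (suc (index v))) v

  limit-locally-good : ∀ N → ∃ λ χ′ → (∀ {u} → index u < N → limit u ≡ χ′ u) × GoodUpTo N χ′
  limit-locally-good N =
    let χ′ , agree , good = proj₂ (chain N) N
    in χ′ , (λ u<N → trans (chain-agree u<N ≤-refl) (agree u<N)) , good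

  limit-colouring : ListColouring L limit
  limit-colouring v =
    let χ′ , same , χ′∈ , _ = limit-locally-good (suc (index v)) in subst (_∈ L v) (sym (same ≤-refl)) (χ′∈ v)

  limit-majority : ∀ v → FiniteMajorityAt limit v
  limit-majority v l enum m m! mono with limit-locally-good (suc (maxIndex (v ∷ l)))
  ... | χ′ , same , _ , good =
    ≤-trans (*-monoʳ-≤ k (length≤count m (prefix N) m! embed)) (good (∈-prefix⁺ N (below (here refl))) (l , enum))
    where
    N : ℕ
    N = suc (maxIndex (v ∷ l))
    below : ∀ {u} → u ∈ v ∷ l → index u < N
    below u∈ = s≤s (index≤maxIndex u∈)
    embed : ∀ {u} → u ∈ m → u ∈ prefix N × Mono χ′ v u
    embed u∈ =
      let e , eq = mono u∈
          u∈l = there (Equivalence.to (proj₂ enum _) e)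
      in ∈-prefix⁺ N (below u∈l) , e , trans (sym (same (below u∈l))) (trans eq (same (below (here refl))))

module Designation (em : ExcludedMiddle 0ℓ) {V : Set} (index : V → ℕ) (index-injective : Injective _≡_ _≡_ index)
    (R : V → V → Set) where

  open Classical em
  open Indexing em index index-injective

  Infinite : V → Set
  Infinite v = ¬ FiniteSet (R v)

  infinite-unbounded : ∀ {v} → Infinite v → ∀ B → ∃ λ w → R v w × B < index w
  infinite-unbounded {v} infinite B with em {∃ λ w → R v w × B < index w}
  ... | yes found = found
  ... | no none = contradiction (finite-from-cover (R v) (prefix (suc B)) below) infinite
    where
    below : ∀ w → R v w → w ∈ prefix (suc B)
    below w e = ∈-prefix⁺ (suc B) (s≤s (≮⇒≥ λ B<w → none (w , e , B<w)))

  Fresh : ℕ → List (V × V) → V → V → Set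
  Fresh n ps v w = R v w × index v ⊔ n ⊔ maxIndex (map proj₂ ps) < index w

  designate : ℕ → V → List (V × V) → List (V × V)
  designate n v ps with em {∃ (Fresh n ps v)}
  ... | yes (w , _) = (v , w) ∷ ps
  ... | no _ = ps

  -- Every vertex takes part in all stages from its index on, each time designating an out-neighbour of index
  -- beyond the stage; designees are always fresh, so each vertex has at most one designator.
  designations : ℕ → List (V × V)
  designations zero = []
  designations (suc n) = foldr (designate n) (designations n) (prefix (suc n))

  Consistent : List (V × V) → Set
  Consistent ps = All (λ p → R (proj₁ p) (proj₂ p) × index (proj₁ p) < index (proj₂ p)) ps × Unique (map proj₂ ps)

  designate-consistent : ∀ n v {ps} → Consistent ps → Consistent (designate n v ps)
  designate-consistent n v {ps} (edges , targets!) with em {∃ (Fresh n ps v)}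
  ... | no _ = edges , targets!
  ... | yes (w , e , large) =
    (e , ≤-<-trans (≤-trans (m≤m⊔n (index v) n) (m≤m⊔n _ _)) large) ∷ edges ,
    All.tabulate (λ { w∈ refl → >maxIndex⇒∉ (≤-<-trans (m≤n⊔m _ _) large) w∈ }) ∷ targets!

  designate-⊇ : ∀ n v {ps} → ps ⊆ designate n v ps
  designate-⊇ n v {ps} p∈ with em {∃ (Fresh n ps v)}
  ... | yes _ = there p∈
  ... | no _ = p∈

  designations-consistent : ∀ n → Consistent (designations n)
  designations-consistent zero = [] , []
  designations-consistent (suc n) =
    foldr-preserves {P = Consistent} (λ v → designate-consistent n v) (designations-consistent n) (prefix (suc n))

  designations-mono : ∀ {m n} → m ≤ n → designations m ⊆ designations n
  designations-mono {m} {n} m≤n with m≤n⇒m<n∨m≡n m≤n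
  ... | inj₂ refl = λ p∈ → p∈
  designations-mono {m} {suc n} _ | inj₁ m<1+n =
    foldr-preserves {P = designations m ⊆_} (λ v ⊆ps → designate-⊇ n v ∘′ ⊆ps)
      (designations-mono (≤-pred m<1+n)) (prefix (suc n))

  designate-hits : ∀ n {v} ps vs → v ∈ vs → Infinite v → ∃ λ w → (v , w) ∈ foldr (designate n) ps vs × n < index w
  designate-hits n {v} ps (v ∷ vs) (here refl) infinite with em {∃ (Fresh n (foldr (designate n) ps vs) v)}
  ... | yes (w , _ , large) = w , here refl , ≤-<-trans (≤-trans (m≤n⊔m (index v) n) (m≤m⊔n _ _)) large
  ... | no none = contradiction (infinite-unbounded infinite _) none
  designate-hits n ps (x ∷ vs) (there v∈) infinite =
    let w , p∈ , large = designate-hits n ps vs v∈ infinite in w , designate-⊇ n x p∈ , large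

  Designated : V → V → Set
  Designated v w = ∃ λ n → (v , w) ∈ designations n

  Designated-edge : ∀ {v w} → Designated v w → R v w × index v < index w
  Designated-edge (n , p∈) = All.lookup (proj₁ (designations-consistent n)) p∈

  Designated-functional : ∀ {v v′ w} → Designated v w → Designated v′ w → v ≡ v′
  Designated-functional (n , p∈) (n′ , q∈) = Unique-targets⇒functional (proj₂ (designations-consistent (n ⊔ n′)))
    (designations-mono (m≤m⊔n n n′) p∈) (designations-mono (m≤n⊔m n n′) q∈)

  infinitely-designated : ∀ {v} → Infinite v → ∀ (xs : List V) → ∃ λ w → Designated v w × w ∉ xs
  infinitely-designated {v} infinite xs =
    let w , p∈ , large = designate-hits n (designations n) (prefix (suc n)) (∈-prefix⁺ (suc n) (s≤s (m≤m⊔n _ _))) infinite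
    in w , (suc n , p∈) , >maxIndex⇒∉ (≤-<-trans (m≤n⊔m (index v) _) large)
    where
    n : ℕ
    n = index v ⊔ maxIndex xs

module Choosability (em : ExcludedMiddle 0ℓ) (k : ℕ) (1≤k : 1 ≤ k) {V : Set} (index : V → ℕ)
    (index-injective : Injective _≡_ _≡_ index) (R : V → V → Set) (finitely : FinitelyColourable em k R)
    {C : Set} (L : V → List C) (L-assignment : ListAssignment V C (suc k) L) where

  open Classical em
  open Designation em index index-injective R

  allowed : (V → C) → V → List C
  allowed χ w with em {∃ λ v → Designated v w}
  ... | yes (v , _) = L w ∖ χ v
  ... | no _ = L w

  allowed-⊆ : ∀ χ w → allowed χ w ⊆ L w
  allowed-⊆ χ w c∈ with em {∃ λ v → Designated v w}
  ... | yes (v , _) = proj₁ (∈-∖⁻ (L w) c∈)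
  ... | no _ = c∈

  allowed-proper : ∀ χ w → Unique (allowed χ w) × k ≤ length (allowed χ w)
  allowed-proper χ w with em {∃ λ v → Designated v w} | L-assignment w
  ... | yes (v , _) | L! , |L|≡1+k =
    ∖-unique (χ v) L! , ≤-pred (subst (_≤ suc (length (L w ∖ χ v))) |L|≡1+k (length-∖≥ (L w) L!))
  ... | no _ | L! , |L|≡1+k = L! , subst (k ≤_) (sym |L|≡1+k) (n≤1+n k)

  allowed-nonempty : ∀ χ w → 0 < length (allowed χ w)
  allowed-nonempty χ w = ≤-trans 1≤k (proj₂ (allowed-proper χ w))

  allowed-avoids : ∀ {χ v w c} → Designated v w → c ∈ allowed χ w → c ≢ χ v
  allowed-avoids {v = v} {w} d c∈ with em {∃ λ v → Designated v w}
  ... | yes (v′ , d′) rewrite Designated-functional d d′ = proj₂ (∈-∖⁻ (L w) c∈)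
  ... | no none = contradiction (v , d) none

  allowed-cong : ∀ {χ χ′} w → (∀ {v} → Designated v w → χ v ≡ χ′ v) → allowed χ w ≡ allowed χ′ w
  allowed-cong w same with em {∃ λ v → Designated v w}
  ... | yes (v , d) = cong (L w ∖_) (same d)
  ... | no _ = refl

  -- Designators have smaller index, so preColour n is already final on vertices of index below n.
  preColour : ℕ → V → C
  preColour zero w = firstOf (L w) (subst (0 <_) (sym (proj₂ (L-assignment w))) z<s)
  preColour (suc n) w = firstOf (allowed (preColour n) w) (allowed-nonempty (preColour n) w)

  preColour-stable : ∀ m n w → index w < m → index w < n → preColour m w ≡ preColour n w
  preColour-stable (suc m) (suc n) w w<1+m w<1+n = firstOf-cong (allowed-cong w λ d →
    let v<w = proj₂ (Designated-edge d)
    in preColour-stable m n _ (<-≤-trans v<w (≤-pred w<1+m)) (<-≤-trans v<w (≤-pred w<1+n)))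

  precolouring : V → C
  precolouring w = preColour (suc (index w)) w

  precolouring-allowed : ∀ w → precolouring w ∈ allowed precolouring w
  precolouring-allowed w = subst (precolouring w ∈_) (allowed-cong w settled) (firstOf-∈ _ _)
    where
    settled : ∀ {v} → Designated v w → preColour (index w) v ≡ precolouring v
    settled {v} d = preColour-stable (index w) (suc (index v)) v (proj₂ (Designated-edge d)) ≤-refl

  restricted : V → List C
  restricted w with em {FiniteSet (R w)}
  ... | yes _ = allowed precolouring w
  ... | no _ = precolouring w ∷ []

  restricted-⊆ : ∀ w → restricted w ⊆ allowed precolouring w
  restricted-⊆ w c∈ with em {FiniteSet (R w)}
  ... | yes _ = c∈
  restricted-⊆ w (here refl) | no _ = precolouring-allowed w

  restricted-infinite : ∀ {w c} → Infinite w → c ∈ restricted w → c ≡ precolouring w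
  restricted-infinite {w} infinite c∈ with em {FiniteSet (R w)}
  ... | yes finite = contradiction finite infinite
  restricted-infinite infinite (here refl) | no _ = refl

  restricted-proper : ∀ w → FiniteSet (R w) → Unique (restricted w) × k ≤ length (restricted w)
  restricted-proper w finite with em {FiniteSet (R w)}
  ... | yes _ = allowed-proper precolouring w
  ... | no infinite = contradiction finite infinite

  precolouring-restricted : ListColouring restricted precolouring
  precolouring-restricted w with em {FiniteSet (R w)}
  ... | yes _ = precolouring-allowed w
  ... | no _ = here refl

  majority-colouring : ∃ λ χ → ListColouring L χ × MajorityColouring k R χ
  majority-colouring =
    limit , (λ v → allowed-⊆ _ v (restricted-⊆ v (limit-colouring v))) , λ v → limit-majority v , infinite-clause
    where
    open Compactness em k index index-injective R restricted
           (finitely restricted restricted-proper precolouring precolouring-restricted)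
    infinite-clause : ∀ {v} → Infinite v → ∀ xs → ∃ λ u → R v u × u ∉ xs × limit u ≢ limit v
    infinite-clause {v} infinite xs =
      let w , d , w∉ = infinitely-designated infinite xs
      in w , proj₁ (Designated-edge d) , w∉ ,
         λ same → allowed-avoids d (restricted-⊆ w (limit-colouring w)) (trans same (restricted-infinite infinite (limit-colouring v)))

theorem8 : ExcludedMiddle 0ℓ → (k : ℕ) → 2 ≤ k →
    ((V : Set) → Countable V → (E : V → V → Set) → IsGraph E →
      MajorityChoosable V k (suc k) E)
    ×
    ((V : Set) → Countable V → (D : V → V → Set) → IsAcyclic D →
      MajorityChoosable V k (suc k) D)
theorem8 em k 2≤k =
  (λ V (index , index-injective) E graph C L L-assignment →
     Choosability.majority-colouring em k 1≤k index index-injective E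
       (λ L′ L′-proper → GraphMajority.majority-on-graph em k E graph L′ _ L′-proper) L L-assignment) ,
  (λ V (index , index-injective) D acyclic C L L-assignment →
     Choosability.majority-colouring em k 1≤k index index-injective D
       (λ L′ L′-proper χ₀ χ₀∈ Y _ → AcyclicMajority.majority-on-acyclic em k D acyclic L′ _ L′-proper χ₀ χ₀∈ Y) L L-assignment)
  where
  1≤k : 1 ≤ k
  1≤k = ≤-trans (s≤s z≤n) 2≤k
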